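{- Let $T_5=\{12,1\overline{2},\overline{2}1\}$. Then $b_n(T_5\cup\{\overline{2}\,\overline{1}\})=2^n$ for every $n\ge 0$.
   Context: A signed permutation of length $n$ is a word $\alpha=\alpha_1\cdots\alpha_n$ in which each of the symbols $1,\dots,n$ appears exactly once, each occurrence possibly barred (written $\overline{i}$). The set of all of them is $B_n$, and $B_0$ consists of the empty word. For a symbol $x$, $|x|$ denotes the underlying number with any bar removed. For $\tau=\tau_1\cdots\tau_k\in B_k$ and $\alpha\in B_n$, $\alpha$ contains $\tau$ if there are indices $1\le i_1<\cdots<i_k\le n$ such that (1) $|\alpha_{i_p}|>|\alpha_{i_q}|$ if and only if $|\tau_p|>|\tau_q|$ for all $p,q$, and (2) $\alpha_{i_j}$ is barred if and only if $\tau_j$ is barred for every $j$. Otherwise $\alpha$ avoids $\tau$. $B_n(T)$ is the set of $\alpha\in B_n$ avoiding every pattern in $T$, and $b_n(T)=|B_n(T)|$. -}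

module Defs where

open import Data.Bool using (Bool; true; false; _∧_; not; if_then_else_)
open import Data.Bool.Properties using () renaming (_≟_ to _≟ᴮ_)
open import Data.Nat using (ℕ; zero; suc; _<ᵇ_; _≡ᵇ_)
open import Data.Product using (_×_; _,_; proj₁; proj₂)
open import Data.List using (List; []; _∷_; map; concatMap; length; filter; zip; applyUpTo)
open import Data.Bool.ListAction using (all; any)
open import Relation.Nullary.Decidable using (does)

Letter : Set
Letter = Bool × ℕ

bar : ℕ → Letter
bar i = (true , i)

unb : ℕ → Letter
unb i = (false , i)

∣_∣ˡ : Letter → ℕ
∣ x ∣ˡ = proj₂ x

barred : Letter → Bool
barred x = proj₁ x

Word : Set
Word = List Letter

words : List Letter → ℕ → List Word
words A zero    = [] ∷ []
words A (suc n) = concatMap (λ a → map (a ∷_) (words A n)) A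

alphabet : ℕ → List Letter
alphabet n = concatMap (λ i → unb i ∷ bar i ∷ []) (applyUpTo suc n)

occ : ℕ → Word → ℕ
occ i []       = 0
occ i (x ∷ w)  = if ∣ x ∣ˡ ≡ᵇ i then suc (occ i w) else occ i w

isSignedPerm : ℕ → Word → Bool
isSignedPerm n w = all (λ i → occ i w ≡ᵇ 1) (applyUpTo suc n)

B : ℕ → List Word
B n = filter (λ w → isSignedPerm n w ≟ᴮ true) (words (alphabet n) n)

subseqs : Word → List Word
subseqs []      = [] ∷ []
subseqs (x ∷ w) = map (x ∷_) (subseqs w) ++′ subseqs w
  where
  _++′_ : List Word → List Word → List Word
  [] ++′ ys       = ys
  (z ∷ zs) ++′ ys = z ∷ (zs ++′ ys)

_==_ : Bool → Bool → Bool
a == b = does (a ≟ᴮ b)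

occurrenceOf : Word → Word → Bool
occurrenceOf σ τ =
  (length σ ≡ᵇ length τ)
  ∧ all (λ st → barred (proj₁ st) == barred (proj₂ st)) ps
  ∧ all (λ st → all (λ st′ →
          (∣ proj₁ st′ ∣ˡ <ᵇ ∣ proj₁ st ∣ˡ) == (∣ proj₂ st′ ∣ˡ <ᵇ ∣ proj₂ st ∣ˡ)) ps) ps
  where
  ps = zip σ τ

contains : Word → Word → Bool
contains α τ = any (λ σ → occurrenceOf σ τ) (subseqs α)

avoidsAll : Word → List Word → Bool
avoidsAll α T = all (λ τ → not (contains α τ)) T

b : ℕ → List Word → ℕ
b n T = length (filter (λ α → avoidsAll α T ≟ᴮ true) (B n))

T₅ : List Word
T₅ = (unb 1 ∷ unb 2 ∷ []) ∷ (unb 1 ∷ bar 2 ∷ []) ∷ (bar 2 ∷ unb 1 ∷ []) ∷ []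

-- A two-letter word is an occurrence of 2̄1̄, 2̄1, 12 or 12̄ exactly when a barred
-- letter is followed by a smaller one or an unbarred letter by a larger one.
-- As all four patterns have length two, a signed permutation avoids them iff
-- every barred letter is smaller, and every unbarred letter larger, than all
-- letters after it. For a signed permutation of an interval [lo, lo + m) this
-- forces the first letter to be bar lo or unb (lo + m - 1), and the rest is again
-- such a permutation of an interval of length m - 1; so there are 2^m of them.

module Submission where

open import Defs
open import Data.Nat using (ℕ; _^_)
open import Data.List using (List; []; _∷_)
open import Relation.Binary.PropositionalEquality using (_≡_)

open import Data.Bool using (Bool; true; false; not; if_then_else_)
open import Data.Bool.ListAction using (all; any)
open import Data.Bool.Properties using (T-≡; ¬-not; not-¬; not-involutive) renaming (_≟_ to _≟ᴮ_)
open import Data.Empty using (⊥-elim)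
import Data.List as List
open import Data.List using (length; map; _++_; concatMap; filter; applyUpTo)
open import Data.List.Membership.Propositional using (_∈_; _∉_)
open import Data.List.Membership.Propositional.Properties
  using (∈-++⁺ˡ; ∈-++⁺ʳ; ∈-++⁻; ∈-map⁺; ∈-map⁻; ∈-concat⁺′; ∈-concat⁻′;
         ∈-applyUpTo⁺; ∈-applyUpTo⁻)
open import Data.List.Properties using (filter-++; length-++; filter-none; map-cong)
open import Data.List.Relation.Unary.All as All using (All; []; _∷_)
open import Data.List.Relation.Unary.AllPairs as AllPairs using (AllPairs; []; _∷_)
import Data.List.Relation.Unary.AllPairs.Properties as AllPairs
import Data.List.Relation.Unary.All.Properties as All
open import Data.List.Relation.Unary.Any using (here; there)
open import Data.List.Relation.Unary.Unique.Propositional using (Unique)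
open import Data.List.Relation.Unary.Unique.Propositional.Properties
  using (Unique[x∷xs]⇒x∉xs) renaming (concat⁺ to Unique-concat⁺)
open import Data.Nat using (zero; suc; _+_; _≤_; _<_; _<ᵇ_; _≡ᵇ_; z≤n; s≤s)
open import Data.Nat.ListAction using (sum)
open import Data.Nat.Properties
  using (_≟_; ≡ᵇ⇒≡; ≡⇒≡ᵇ; <ᵇ⇒<; <⇒<ᵇ;
         ≤-refl; ≤-trans; ≤-<-trans; ≤-antisym; ≤-reflexive; ≤-pred;
         <⇒≤; <⇒≱; <⇒≯; ≮⇒≥; <⇒≢; ≤∧≢⇒<; m≤m+n; m<m+n; m<n⇒m<1+n; suc-injective;
         +-suc; +-identityʳ; +-commutativeSemigroup)
open import Algebra.Properties.CommutativeSemigroup +-commutativeSemigroup using (interchange)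
open import Data.Product using (_×_; _,_; proj₁; proj₂; Σ-syntax)
open import Data.Product.Properties using (≡-dec)
open import Data.Sum using (_⊎_; inj₁; inj₂; [_,_])
open import Function using (_∘_; _⇔_; mk⇔; Equivalence)
open import Function.Properties.Equivalence using () renaming (sym to ⇔-sym)
open import Relation.Binary.Definitions using (DecidableEquality)
open import Relation.Binary.PropositionalEquality
  using (refl; sym; trans; cong; cong₂; subst; _≢_; module ≡-Reasoning)
open import Relation.Nullary using (¬_; yes; no; does)
open import Relation.Nullary.Negation using (contradiction)
import Relation.Nullary.Decidable as Dec
open import Level using (0ℓ)
open import Relation.Unary using (Pred; Decidable; _≐_; _∖_; ｛_｝)
open import Relation.Unary.Properties using (_∩?_; ≐-sym)

open Equivalence using (to; from)

≡ᵇ-true⇔ : ∀ {m n} → (m ≡ᵇ n) ≡ true ⇔ m ≡ n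
≡ᵇ-true⇔ {m} {n} = mk⇔ (≡ᵇ⇒≡ m n ∘ from T-≡) (to T-≡ ∘ ≡⇒≡ᵇ m n)

<ᵇ-true⇔ : ∀ {m n} → (m <ᵇ n) ≡ true ⇔ m < n
<ᵇ-true⇔ {m} {n} = mk⇔ (<ᵇ⇒< m n ∘ from T-≡) (to T-≡ ∘ <⇒<ᵇ)

≮⇒<ᵇ≡false : ∀ {m n} → ¬ m < n → (m <ᵇ n) ≡ false
≮⇒<ᵇ≡false m≮n = ¬-not (m≮n ∘ to <ᵇ-true⇔)

n≡ᵇn≡true : ∀ n → (n ≡ᵇ n) ≡ true
n≡ᵇn≡true zero    = refl
n≡ᵇn≡true (suc n) = n≡ᵇn≡true n

n<ᵇn≡false : ∀ n → (n <ᵇ n) ≡ false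
n<ᵇn≡false zero    = refl
n<ᵇn≡false (suc n) = n<ᵇn≡false n

module _ {A : Set} (p : A → Bool) where

  all≡true⁺ : ∀ xs → (∀ {x} → x ∈ xs → p x ≡ true) → all p xs ≡ true
  all≡true⁺ []       _ = refl
  all≡true⁺ (x ∷ xs) h rewrite h (here refl) = all≡true⁺ xs (h ∘ there)

  all≡true⁻ : ∀ {xs x} → all p xs ≡ true → x ∈ xs → p x ≡ true
  all≡true⁻ {y ∷ _} e (here refl) with p y | e
  ... | true | _ = refl
  all≡true⁻ {y ∷ _} e (there x∈) with p y | e
  ... | true | e′ = all≡true⁻ e′ x∈

  any≡false⁺ : ∀ xs → (∀ {x} → x ∈ xs → p x ≡ false) → any p xs ≡ false
  any≡false⁺ []       _ = refl
  any≡false⁺ (x ∷ xs) h rewrite h (here refl) = any≡false⁺ xs (h ∘ there)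

  any≡false⁻ : ∀ {xs x} → any p xs ≡ false → x ∈ xs → p x ≡ false
  any≡false⁻ {y ∷ _} e (here refl) with p y | e
  ... | false | _ = refl
  any≡false⁻ {y ∷ _} e (there x∈) with p y | e
  ... | false | e′ = any≡false⁻ e′ x∈

-- Counting

count : ∀ {A : Set} {P : Pred A 0ℓ} → Decidable P → List A → ℕ
count P? = length ∘ filter P?

module _ {A : Set} {P : Pred A 0ℓ} (P? : Decidable P) where

  count-++ : ∀ xs ys → count P? (xs ++ ys) ≡ count P? xs + count P? ys
  count-++ xs ys = trans (cong length (filter-++ P? xs ys)) (length-++ (filter P? xs))

  count-map : ∀ {B : Set} (f : B → A) xs → count P? (map f xs) ≡ count (P? ∘ f) xs
  count-map f []       = refl
  count-map f (x ∷ xs) with does (P? (f x))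
  ... | true  = cong suc (count-map f xs)
  ... | false = count-map f xs

  count-concatMap : ∀ {B : Set} (f : B → List A) xs → count P? (concatMap f xs) ≡ sum (map (count P? ∘ f) xs)
  count-concatMap f []       = refl
  count-concatMap f (x ∷ xs) = trans (count-++ (f x) _) (cong (count P? (f x) +_) (count-concatMap f xs))

  count-none : ∀ xs → (∀ {x} → ¬ P x) → count P? xs ≡ 0
  count-none xs ¬P = cong length (filter-none P? (All.universal (λ _ → ¬P) xs))

  module _ {Q : Pred A 0ℓ} (Q? : Decidable Q) where

    count-cong-∈ : ∀ {xs} → (∀ {x} → x ∈ xs → P x ⇔ Q x) → count P? xs ≡ count Q? xs
    count-cong-∈ {[]}     _     = refl
    count-cong-∈ {x ∷ xs} P⇔Q with P? x | Q? x
    ... | yes _  | yes _  = cong suc (count-cong-∈ (P⇔Q ∘ there))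
    ... | no _   | no _   = count-cong-∈ (P⇔Q ∘ there)
    ... | yes px | no ¬qx = contradiction (to (P⇔Q (here refl)) px) ¬qx
    ... | no ¬px | yes qx = contradiction (from (P⇔Q (here refl)) qx) ¬px

    count-filter : ∀ xs → count Q? (filter P? xs) ≡ count (P? ∩? Q?) xs
    count-filter []       = refl
    count-filter (x ∷ xs) with P? x
    ... | no _ = count-filter xs
    ... | yes _ with Q? x
    ...   | yes _ = cong suc (count-filter xs)
    ...   | no _  = count-filter xs

count-words-suc : ∀ {P : Pred Word 0ℓ} (P? : Decidable P) A m →
  count P? (words A (suc m)) ≡ sum (map (λ a → count (P? ∘ (a ∷_)) (words A m)) A)
count-words-suc P? A m =
  trans (count-concatMap P? _ A) (cong sum (map-cong (λ a → count-map P? (a ∷_) (words A m)) A))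

module _ {A : Set} (_≟ᴬ_ : DecidableEquality A) where

  pointMass : A → ℕ → A → ℕ
  pointMass x c a = if does (a ≟ᴬ x) then c else 0

  sum-pointMass-∉ : ∀ {x c xs} → x ∉ xs → sum (map (pointMass x c) xs) ≡ 0
  sum-pointMass-∉ {x} {xs = []}     _   = refl
  sum-pointMass-∉ {x} {xs = y ∷ ys} x∉ with y ≟ᴬ x
  ... | yes refl = contradiction (here refl) x∉
  ... | no _     = sum-pointMass-∉ (x∉ ∘ there)

  sum-pointMass : ∀ {x c xs} → Unique xs → x ∈ xs → sum (map (pointMass x c) xs) ≡ c
  sum-pointMass {x} {c} {y ∷ ys} unique x∈ with y ≟ᴬ x | x∈
  ... | yes refl | _         = trans (cong (c +_) (sum-pointMass-∉ (Unique[x∷xs]⇒x∉xs unique))) (+-identityʳ c)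
  ... | no y≢x   | here x≡y  = contradiction (sym x≡y) y≢x
  ... | no _     | there x∈ys = sum-pointMass (AllPairs.tail unique) x∈ys

sum-map-+ : ∀ {A : Set} (f g : A → ℕ) xs → sum (map (λ x → f x + g x) xs) ≡ sum (map f xs) + sum (map g xs)
sum-map-+ f g []       = refl
sum-map-+ f g (x ∷ xs) = trans (cong (f x + g x +_) (sum-map-+ f g xs)) (interchange (f x) (g x) _ _)

-- Subsequences and pattern occurrences

-- subseqs appends with a private copy of _++_; once the prefix is abstracted,
-- the hole in the type of go is solved by that copy.
subseqs-∷ : ∀ x w → subseqs (x ∷ w) ≡ map (x ∷_) (subseqs w) ++ subseqs w
subseqs-∷ x w = unfolded
  where
  go : ∀ ys → _ ≡ ys ++ subseqs w
  go []       = refl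
  go (y ∷ ys) = cong (y ∷_) (go ys)
  unfolded : subseqs (x ∷ w) ≡ map (x ∷_) (subseqs w) ++ subseqs w
  unfolded with map (List._∷_ x) (subseqs w)
  ... | prefix = go prefix

module _ (x : Letter) (w : Word) where

  ∈-subseqs-keep : ∀ {σ} → σ ∈ subseqs w → x ∷ σ ∈ subseqs (x ∷ w)
  ∈-subseqs-keep σ∈ = subst (_ ∈_) (sym (subseqs-∷ x w)) (∈-++⁺ˡ (∈-map⁺ (x ∷_) σ∈))

  ∈-subseqs-skip : ∀ {σ} → σ ∈ subseqs w → σ ∈ subseqs (x ∷ w)
  ∈-subseqs-skip σ∈ = subst (_ ∈_) (sym (subseqs-∷ x w)) (∈-++⁺ʳ _ σ∈)

  ∈-subseqs-∷⁻ : ∀ {σ} → σ ∈ subseqs (x ∷ w) →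
                 (Σ[ σ′ ∈ Word ] σ′ ∈ subseqs w × σ ≡ x ∷ σ′) ⊎ σ ∈ subseqs w
  ∈-subseqs-∷⁻ σ∈ with ∈-++⁻ (map (x ∷_) (subseqs w)) (subst (_ ∈_) (subseqs-∷ x w) σ∈)
  ... | inj₁ σ∈keep = inj₁ (∈-map⁻ (x ∷_) σ∈keep)
  ... | inj₂ σ∈skip = inj₂ σ∈skip

[]∈subseqs : ∀ w → [] ∈ subseqs w
[]∈subseqs []      = here refl
[]∈subseqs (x ∷ w) = ∈-subseqs-skip x w ([]∈subseqs w)

[-]∈subseqs : ∀ {y w} → y ∈ w → y ∷ [] ∈ subseqs w
[-]∈subseqs {w = x ∷ w} (here refl) = ∈-subseqs-keep x w ([]∈subseqs w)
[-]∈subseqs {w = x ∷ w} (there y∈) = ∈-subseqs-skip x w ([-]∈subseqs y∈)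

All-subseqs : ∀ {P : Letter → Set} {w σ} → All P w → σ ∈ subseqs w → All P σ
All-subseqs {w = []} [] (here refl) = []
All-subseqs {w = x ∷ w} (px ∷ pw) σ∈ with ∈-subseqs-∷⁻ x w σ∈
... | inj₁ (σ′ , σ′∈ , refl) = px ∷ All-subseqs pw σ′∈
... | inj₂ σ∈w              = All-subseqs pw σ∈w

AllPairs-subseqs : ∀ {R : Letter → Letter → Set} {w σ} → AllPairs R w → σ ∈ subseqs w → AllPairs R σ
AllPairs-subseqs {w = []} [] (here refl) = []
AllPairs-subseqs {w = x ∷ w} (rx ∷ rw) σ∈ with ∈-subseqs-∷⁻ x w σ∈
... | inj₁ (σ′ , σ′∈ , refl) = All-subseqs rx σ′∈ ∷ AllPairs-subseqs rw σ′∈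
... | inj₂ σ∈w              = AllPairs-subseqs rw σ∈w

AllPairs⇔subseqs : ∀ {w} {R : Letter → Letter → Set} →
                   AllPairs R w ⇔ (∀ {a b} → a ∷ b ∷ [] ∈ subseqs w → R a b)
AllPairs⇔subseqs = mk⇔ pairs⇐ pairs⇒
  where
  pairs⇐ : ∀ {R w} → AllPairs R w → ∀ {a b} → a ∷ b ∷ [] ∈ subseqs w → R a b
  pairs⇐ rw ab∈ with AllPairs-subseqs rw ab∈
  ... | (rab ∷ []) ∷ _ = rab
  pairs⇒ : ∀ {R w} → (∀ {a b} → a ∷ b ∷ [] ∈ subseqs w → R a b) → AllPairs R w
  pairs⇒ {w = []}    _ = []
  pairs⇒ {w = x ∷ w} h =
    All.tabulate (h ∘ ∈-subseqs-keep x w ∘ [-]∈subseqs) ∷ pairs⇒ (h ∘ ∈-subseqs-skip x w)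

occurrenceOf-length : ∀ {σ τ} → length σ ≢ length τ → occurrenceOf σ τ ≡ false
occurrenceOf-length {σ} {τ} σ≢τ with length σ ≡ᵇ length τ in eq
... | false = refl
... | true  = contradiction (to ≡ᵇ-true⇔ eq) σ≢τ

occurrenceOf-pair⇔ : ∀ a b c d →
  occurrenceOf (a ∷ b ∷ []) (c ∷ d ∷ []) ≡ true
    ⇔ (barred a ≡ barred c × barred b ≡ barred d ×
       (∣ b ∣ˡ <ᵇ ∣ a ∣ˡ) ≡ (∣ d ∣ˡ <ᵇ ∣ c ∣ˡ) ×
       (∣ a ∣ˡ <ᵇ ∣ b ∣ˡ) ≡ (∣ c ∣ˡ <ᵇ ∣ d ∣ˡ))
-- occurrenceOf also compares every letter with itself; those n <ᵇ n are stuck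
-- on variables until rewritten away.
occurrenceOf-pair⇔ (s , x) (t , y) (c , p) (d , q)
  rewrite n<ᵇn≡false x | n<ᵇn≡false y | n<ᵇn≡false p | n<ᵇn≡false q
  with s ≟ᴮ c | t ≟ᴮ d | (y <ᵇ x) ≟ᴮ (q <ᵇ p) | (x <ᵇ y) ≟ᴮ (p <ᵇ q)
... | yes s≡c | yes t≡d | yes yx | yes xy = mk⇔ (λ _ → s≡c , t≡d , yx , xy) (λ _ → refl)
... | no s≢c  | _       | _      | _      = mk⇔ (λ ()) (⊥-elim ∘ s≢c ∘ proj₁)
... | yes _   | no t≢d  | _      | _      = mk⇔ (λ ()) (⊥-elim ∘ t≢d ∘ proj₁ ∘ proj₂)
... | yes _   | yes _   | no yx  | _      = mk⇔ (λ ()) (⊥-elim ∘ yx ∘ proj₁ ∘ proj₂ ∘ proj₂)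
... | yes _   | yes _   | yes _  | no xy  = mk⇔ (λ ()) (⊥-elim ∘ xy ∘ proj₂ ∘ proj₂ ∘ proj₂)

avoidsAll⁺ : ∀ {α T} → (∀ {σ τ} → σ ∈ subseqs α → τ ∈ T → occurrenceOf σ τ ≡ false) →
             avoidsAll α T ≡ true
avoidsAll⁺ {α} {T} h =
  all≡true⁺ _ T λ τ∈ → cong not (any≡false⁺ _ (subseqs α) λ σ∈ → h σ∈ τ∈)

avoidsAll⁻ : ∀ {α T σ τ} → avoidsAll α T ≡ true →
             σ ∈ subseqs α → τ ∈ T → occurrenceOf σ τ ≡ false
avoidsAll⁻ avoids σ∈ τ∈ =
  any≡false⁻ _ (trans (sym (not-involutive _)) (cong not (all≡true⁻ _ avoids τ∈))) σ∈

PairAvoids : List Word → Letter → Letter → Set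
PairAvoids T a b = ∀ {τ} → τ ∈ T → occurrenceOf (a ∷ b ∷ []) τ ≡ false

avoidsAll⇔AllPairs : ∀ {α T} → All (λ τ → length τ ≡ 2) T →
                     avoidsAll α T ≡ true ⇔ AllPairs (PairAvoids T) α
avoidsAll⇔AllPairs {α} {T} lengths = mk⇔ pairwise pairwise⁻¹
  where
  pairwise : avoidsAll α T ≡ true → AllPairs (PairAvoids T) α
  pairwise avoids = from (AllPairs⇔subseqs {R = PairAvoids T}) λ ab∈ → avoidsAll⁻ {α} {T} avoids ab∈
  notPair : ∀ σ {τ} → length σ ≢ 2 → τ ∈ T → occurrenceOf σ τ ≡ false
  notPair σ {τ} σ≢2 τ∈ =
    occurrenceOf-length {σ} {τ} λ σ≡τ → σ≢2 (trans σ≡τ (All.lookup lengths τ∈))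
  subsequence : AllPairs (PairAvoids T) α →
                ∀ σ {τ} → σ ∈ subseqs α → τ ∈ T → occurrenceOf σ τ ≡ false
  subsequence _     σ@[]              _  = notPair σ λ ()
  subsequence _     σ@(_ ∷ [])        _  = notPair σ λ ()
  subsequence pairs (_ ∷ _ ∷ [])      σ∈ = to AllPairs⇔subseqs pairs σ∈
  subsequence _     σ@(_ ∷ _ ∷ _ ∷ _) _  = notPair σ λ ()
  pairwise⁻¹ : AllPairs (PairAvoids T) α → avoidsAll α T ≡ true
  pairwise⁻¹ pairs = avoidsAll⁺ {α} {T} λ σ∈ → subsequence pairs _ σ∈

-- Signed permutations

occ-∷-≢ : ∀ a w {i} → ∣ a ∣ˡ ≢ i → occ i (a ∷ w) ≡ occ i w
occ-∷-≢ a w {i} a≢i with ∣ a ∣ˡ ≡ᵇ i in eq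
... | false = refl
... | true  = contradiction (to ≡ᵇ-true⇔ eq) a≢i

occ-∷-≡ : ∀ a w → occ ∣ a ∣ˡ (a ∷ w) ≡ suc (occ ∣ a ∣ˡ w)
occ-∷-≡ a w rewrite n≡ᵇn≡true ∣ a ∣ˡ = refl

occ≡0⇔ : ∀ {i} w → occ i w ≡ 0 ⇔ All (λ b → ∣ b ∣ˡ ≢ i) w
occ≡0⇔ w = mk⇔ (absent⁺ w) absent⁻
  where
  absent⁺ : ∀ {i} w → occ i w ≡ 0 → All (λ b → ∣ b ∣ˡ ≢ i) w
  absent⁺         []      _     = []
  absent⁺ {i} (a ∷ w) occ≡0 with ∣ a ∣ˡ ≟ i
  ... | yes refl = contradiction (trans (sym (occ-∷-≡ a w)) occ≡0) λ ()
  ... | no a≢i   = a≢i ∷ absent⁺ w (trans (sym (occ-∷-≢ a w a≢i)) occ≡0)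
  absent⁻ : ∀ {i w} → All (λ b → ∣ b ∣ˡ ≢ i) w → occ i w ≡ 0
  absent⁻                 []            = refl
  absent⁻ {w = a ∷ w} (a≢i ∷ w≢i) = trans (occ-∷-≢ a w a≢i) (absent⁻ w≢i)

occ-below-min : ∀ {x i} w → All (λ b → x ≤ ∣ b ∣ˡ) w → i < x → occ i w ≡ 0
occ-below-min w x≤w i<x = from (occ≡0⇔ w) (All.map (λ x≤b b≡i → <⇒≱ i<x (subst (_ ≤_) b≡i x≤b)) x≤w)

occ-above-max : ∀ {x i} w → All (λ b → ∣ b ∣ˡ ≤ x) w → x < i → occ i w ≡ 0
occ-above-max w w≤x x<i = from (occ≡0⇔ w) (All.map (λ b≤x b≡i → <⇒≱ x<i (subst (_≤ _) b≡i b≤x)) w≤x)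

IsSignedPermOf : Pred ℕ 0ℓ → Word → Set
IsSignedPermOf S w = (∀ {i} → S i → occ i w ≡ 1) × All (S ∘ ∣_∣ˡ) w

IsSignedPermOf-resp-≐ : ∀ {S S′ w} → S ≐ S′ → IsSignedPermOf S w → IsSignedPermOf S′ w
IsSignedPermOf-resp-≐ (S⊆S′ , S′⊆S) (once , within) = once ∘ S′⊆S , All.map S⊆S′ within

IsSignedPermOf-∷⇔ : ∀ {S a w} →
  IsSignedPermOf S (a ∷ w) ⇔ (S ∣ a ∣ˡ × IsSignedPermOf (S ∖ ｛ ∣ a ∣ˡ ｝) w)
IsSignedPermOf-∷⇔ {S} {a} {w} = mk⇔ uncons cons
  where
  uncons : IsSignedPermOf S (a ∷ w) → S ∣ a ∣ˡ × IsSignedPermOf (S ∖ ｛ ∣ a ∣ˡ ｝) w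
  uncons (once , Sa ∷ within) =
    Sa , (λ (Si , a≢i) → trans (sym (occ-∷-≢ a w a≢i)) (once Si)) ,
    All.zipWith (λ (Sb , b≢a) → Sb , b≢a ∘ sym)
      (within , to (occ≡0⇔ w) (suc-injective (trans (sym (occ-∷-≡ a w)) (once Sa))))
  cons : S ∣ a ∣ˡ × IsSignedPermOf (S ∖ ｛ ∣ a ∣ˡ ｝) w → IsSignedPermOf S (a ∷ w)
  cons (Sa , once , within) = once′ , Sa ∷ All.map proj₁ within
    where
    once′ : ∀ {i} → S i → occ i (a ∷ w) ≡ 1
    once′ {i} Si with ∣ a ∣ˡ ≟ i
    ... | yes refl =
      trans (occ-∷-≡ a w) (cong suc (from (occ≡0⇔ w) (All.map (λ (_ , a≢b) → a≢b ∘ sym) within)))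
    ... | no a≢i   = trans (occ-∷-≢ a w a≢i) (once (Si , a≢i))

Interval : ℕ → ℕ → Pred ℕ 0ℓ
Interval lo hi i = lo ≤ i × i < hi

Interval-empty : ∀ {lo hi i} → hi ≤ lo → ¬ Interval lo hi i
Interval-empty hi≤lo (lo≤i , i<hi) = <⇒≱ i<hi (≤-trans hi≤lo lo≤i)

Interval-∖-min : ∀ {lo hi} → Interval lo hi ∖ ｛ lo ｝ ≐ Interval (suc lo) hi
Interval-∖-min = (λ ((lo≤i , i<hi) , lo≢i) → ≤∧≢⇒< lo≤i lo≢i , i<hi)
               , (λ (lo<i , i<hi) → (<⇒≤ lo<i , i<hi) , <⇒≢ lo<i)

Interval-∖-max : ∀ {lo h} → Interval lo (suc h) ∖ ｛ h ｝ ≐ Interval lo h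
Interval-∖-max = (λ ((lo≤i , i≤h) , h≢i) → lo≤i , ≤∧≢⇒< (≤-pred i≤h) (h≢i ∘ sym))
               , (λ (lo≤i , i<h) → (lo≤i , m<n⇒m<1+n i<h) , <⇒≢ i<h ∘ sym)

∈-applyUpTo-suc⇔ : ∀ {N i} → i ∈ applyUpTo suc N ⇔ Interval 1 (suc N) i
∈-applyUpTo-suc⇔ = mk⇔ enumerated enumerates
  where
  enumerated : ∀ {N i} → i ∈ applyUpTo suc N → Interval 1 (suc N) i
  enumerated i∈ with j , j<N , refl ← ∈-applyUpTo⁻ suc i∈ = s≤s z≤n , s≤s j<N
  enumerates : ∀ {N i} → Interval 1 (suc N) i → i ∈ applyUpTo suc N
  enumerates {i = suc j} (_ , s≤s j<N) = ∈-applyUpTo⁺ suc j<N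

signs : ℕ → List Letter
signs i = unb i ∷ bar i ∷ []

∈-signs : ∀ s {i} → (s , i) ∈ signs i
∈-signs false = here refl
∈-signs true  = there (here refl)

∈-signs⇒≡ : ∀ {v i} → v ∈ signs i → ∣ v ∣ˡ ≡ i
∈-signs⇒≡ (here refl)         = refl
∈-signs⇒≡ (there (here refl)) = refl

∈-alphabet⁺ : ∀ {N i} s → Interval 1 (suc N) i → (s , i) ∈ alphabet N
∈-alphabet⁺ s i∈ = ∈-concat⁺′ (∈-signs s) (∈-map⁺ signs (from ∈-applyUpTo-suc⇔ i∈))

∈-alphabet⁻ : ∀ {N a} → a ∈ alphabet N → Interval 1 (suc N) ∣ a ∣ˡ
∈-alphabet⁻ {N} a∈
  with _ , a∈signs , signs∈ ← ∈-concat⁻′ (map signs (applyUpTo suc N)) a∈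
  with i , i∈ , refl ← ∈-map⁻ signs signs∈
  rewrite ∈-signs⇒≡ a∈signs = to ∈-applyUpTo-suc⇔ i∈

unique-alphabet : ∀ N → Unique (alphabet N)
unique-alphabet N = Unique-concat⁺
  (All.map⁺ (All.universal (λ _ → ((λ ()) ∷ []) ∷ [] ∷ []) _))
  (AllPairs.map⁺ (AllPairs.applyUpTo⁺₁ suc N λ i<j _ (v∈i , v∈j) →
    <⇒≢ i<j (suc-injective (trans (sym (∈-signs⇒≡ v∈i)) (∈-signs⇒≡ v∈j)))))

∈-words⁻ : ∀ {A n w} → w ∈ words A n → All (_∈ A) w
∈-words⁻ {n = zero}  (here refl) = []
∈-words⁻ {A} {suc n} w∈
  with _ , w∈ws , ws∈ ← ∈-concat⁻′ (map (λ a → map (a ∷_) (words A n)) A) w∈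
  with a , a∈A , refl ← ∈-map⁻ (λ a → map (a ∷_) (words A n)) ws∈
  with w′ , w′∈ , refl ← ∈-map⁻ (a ∷_) w∈ws
  = a∈A ∷ ∈-words⁻ {A} {n} w′∈

isSignedPerm⇔ : ∀ N w → isSignedPerm N w ≡ true ⇔ (∀ {i} → Interval 1 (suc N) i → occ i w ≡ 1)
isSignedPerm⇔ N w = mk⇔ once once⁻¹
  where
  once : isSignedPerm N w ≡ true → ∀ {i} → Interval 1 (suc N) i → occ i w ≡ 1
  once perm i∈ = to ≡ᵇ-true⇔ (all≡true⁻ (λ i → occ i w ≡ᵇ 1) perm (from ∈-applyUpTo-suc⇔ i∈))
  once⁻¹ : (∀ {i} → Interval 1 (suc N) i → occ i w ≡ 1) → isSignedPerm N w ≡ true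
  once⁻¹ once = all≡true⁺ (λ i → occ i w ≡ᵇ 1) (applyUpTo suc N) λ i∈ →
    from ≡ᵇ-true⇔ (once (to ∈-applyUpTo-suc⇔ i∈))

-- Avoiders of T₅ ∪ {2̄1̄}

T₆ : List Word
T₆ = (bar 2 ∷ bar 1 ∷ []) ∷ T₅

CanPrecede : Letter → Letter → Set
CanPrecede (true  , x) b = x ≤ ∣ b ∣ˡ
CanPrecede (false , x) b = ∣ b ∣ˡ ≤ x

barredDescent∈T₆ : ∀ t → (true , 2) ∷ (t , 1) ∷ [] ∈ T₆
barredDescent∈T₆ true  = here refl
barredDescent∈T₆ false = there (there (there (here refl)))

unbarredAscent∈T₆ : ∀ t → (false , 1) ∷ (t , 2) ∷ [] ∈ T₆
unbarredAscent∈T₆ false = there (here refl)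
unbarredAscent∈T₆ true  = there (there (here refl))

occurs⇒¬CanPrecede : ∀ {a b τ} → τ ∈ T₆ → occurrenceOf (a ∷ b ∷ []) τ ≡ true → ¬ CanPrecede a b
occurs⇒¬CanPrecede {a} {b} (here refl) occurs
  with refl , _ , y<ᵇx , _ ← to (occurrenceOf-pair⇔ a b (bar 2) (bar 1)) occurs
  = <⇒≱ (to <ᵇ-true⇔ y<ᵇx)
occurs⇒¬CanPrecede {a} {b} (there (here refl)) occurs
  with refl , _ , _ , x<ᵇy ← to (occurrenceOf-pair⇔ a b (unb 1) (unb 2)) occurs
  = <⇒≱ (to <ᵇ-true⇔ x<ᵇy)
occurs⇒¬CanPrecede {a} {b} (there (there (here refl))) occurs
  with refl , _ , _ , x<ᵇy ← to (occurrenceOf-pair⇔ a b (unb 1) (bar 2)) occurs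
  = <⇒≱ (to <ᵇ-true⇔ x<ᵇy)
occurs⇒¬CanPrecede {a} {b} (there (there (there (here refl)))) occurs
  with refl , _ , y<ᵇx , _ ← to (occurrenceOf-pair⇔ a b (bar 2) (unb 1)) occurs
  = <⇒≱ (to <ᵇ-true⇔ y<ᵇx)

PairAvoidsT₆⇔CanPrecede : ∀ {a b} → PairAvoids T₆ a b ⇔ CanPrecede a b
PairAvoidsT₆⇔CanPrecede {a} {b} =
  mk⇔ (avoids⇒ a b) λ ab τ∈ → ¬-not λ occurs → occurs⇒¬CanPrecede τ∈ occurs ab
  where
  avoids⇒ : ∀ a b → PairAvoids T₆ a b → CanPrecede a b
  avoids⇒ a@(true , x) b@(t , y) avoids = ≮⇒≥ λ y<x → not-¬ (descent y<x) (avoids (barredDescent∈T₆ t))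
    where
    descent : y < x → occurrenceOf (a ∷ b ∷ []) ((true , 2) ∷ (t , 1) ∷ []) ≡ true
    descent y<x = from (occurrenceOf-pair⇔ a b (true , 2) (t , 1))
      (refl , refl , from <ᵇ-true⇔ y<x , ≮⇒<ᵇ≡false (<⇒≯ y<x))
  avoids⇒ a@(false , x) b@(t , y) avoids = ≮⇒≥ λ x<y → not-¬ (ascent x<y) (avoids (unbarredAscent∈T₆ t))
    where
    ascent : x < y → occurrenceOf (a ∷ b ∷ []) ((false , 1) ∷ (t , 2) ∷ []) ≡ true
    ascent x<y = from (occurrenceOf-pair⇔ a b (false , 1) (t , 2))
      (refl , refl , ≮⇒<ᵇ≡false (<⇒≯ x<y) , from <ᵇ-true⇔ x<y)

Avoider : ℕ → ℕ → Word → Set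
Avoider lo m w = IsSignedPermOf (Interval lo (lo + m)) w × AllPairs CanPrecede w

module _ {lo m : ℕ} where

  lo∈Interval : Interval lo (lo + suc m) lo
  lo∈Interval = ≤-refl , m<m+n lo (s≤s z≤n)

  top∈Interval : Interval lo (lo + suc m) (lo + m)
  top∈Interval rewrite +-suc lo m = m≤m+n lo m , ≤-refl

  avoider-bar⇔ : ∀ {w} → Avoider (suc lo) m w ⇔ Avoider lo (suc m) (bar lo ∷ w)
  avoider-bar⇔ {w} = mk⇔ prepend behead
    where
    interval : Interval lo (lo + suc m) ∖ ｛ lo ｝ ≐ Interval (suc lo) (suc lo + m)
    interval rewrite +-suc lo m = Interval-∖-min
    prepend : Avoider (suc lo) m w → Avoider lo (suc m) (bar lo ∷ w)
    prepend (perm , pairs) =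
      from IsSignedPermOf-∷⇔ (lo∈Interval , IsSignedPermOf-resp-≐ (≐-sym interval) perm) ,
      All.map (λ (lo<b , _) → <⇒≤ lo<b) (proj₂ perm) ∷ pairs
    behead : Avoider lo (suc m) (bar lo ∷ w) → Avoider (suc lo) m w
    behead (perm , _ ∷ pairs) = IsSignedPermOf-resp-≐ interval (proj₂ (to IsSignedPermOf-∷⇔ perm)) , pairs

  avoider-unb⇔ : ∀ {w} → Avoider lo m w ⇔ Avoider lo (suc m) (unb (lo + m) ∷ w)
  avoider-unb⇔ {w} = mk⇔ prepend behead
    where
    interval : Interval lo (lo + suc m) ∖ ｛ lo + m ｝ ≐ Interval lo (lo + m)
    interval rewrite +-suc lo m = Interval-∖-max
    prepend : Avoider lo m w → Avoider lo (suc m) (unb (lo + m) ∷ w)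
    prepend (perm , pairs) =
      from IsSignedPermOf-∷⇔ (top∈Interval , IsSignedPermOf-resp-≐ (≐-sym interval) perm) ,
      All.map (λ (_ , b<top) → <⇒≤ b<top) (proj₂ perm) ∷ pairs
    behead : Avoider lo (suc m) (unb (lo + m) ∷ w) → Avoider lo m w
    behead (perm , _ ∷ pairs) = IsSignedPermOf-resp-≐ interval (proj₂ (to IsSignedPermOf-∷⇔ perm)) , pairs

  avoider-head : ∀ {a w} → Avoider lo (suc m) (a ∷ w) → a ≡ bar lo ⊎ a ≡ unb (lo + m)
  avoider-head {true , x} {w} ((once , (lo≤x , _) ∷ _) , x≤w ∷ _) =
    inj₁ (cong bar (≤-antisym x≤lo lo≤x))
    where
    x≤lo : x ≤ lo
    x≤lo = ≮⇒≥ λ lo<x → contradiction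
      (trans (sym (once lo∈Interval)) (occ-below-min (bar x ∷ w) (≤-refl ∷ x≤w) lo<x)) λ ()
  avoider-head {false , x} {w} ((once , (_ , x<top+1) ∷ _) , w≤x ∷ _) =
    inj₂ (cong unb (≤-antisym x≤top top≤x))
    where
    x≤top : x ≤ lo + m
    x≤top = ≤-pred (subst (x <_) (+-suc lo m) x<top+1)
    top≤x : lo + m ≤ x
    top≤x = ≮⇒≥ λ x<top → contradiction
      (trans (sym (once top∈Interval)) (occ-above-max (unb x ∷ w) (≤-refl ∷ w≤x) x<top)) λ ()

_≟ˡ_ : DecidableEquality Letter
_≟ˡ_ = ≡-dec _≟ᴮ_ _≟_

avoider? : ∀ lo m → Decidable (Avoider lo m)
avoider? lo zero    []      = yes ((⊥-elim ∘ Interval-empty (≤-reflexive (+-identityʳ lo)) , []) , [])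
avoider? lo zero    (a ∷ w) = no λ { ((_ , a∈ ∷ _) , _) → Interval-empty (≤-reflexive (+-identityʳ lo)) a∈ }
avoider? lo (suc m) []      = no λ ((once , _) , _) → contradiction (once lo∈Interval) λ ()
avoider? lo (suc m) (a ∷ w) with a ≟ˡ bar lo | a ≟ˡ unb (lo + m)
... | yes refl | _        = Dec.map avoider-bar⇔ (avoider? (suc lo) m w)
... | no _     | yes refl = Dec.map avoider-unb⇔ (avoider? lo m w)
... | no ≢bar  | no ≢unb  = no ([ ≢bar , ≢unb ] ∘ avoider-head)

-- The case split also unfolds avoider? in the goal, so its predicate is left to
-- unification.
count-avoiders-∷ : ∀ {lo m} a ws →
  count (avoider? lo (suc m) ∘ (a ∷_)) ws
    ≡ pointMass _≟ˡ_ (bar lo) (count (avoider? (suc lo) m) ws) a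
      + pointMass _≟ˡ_ (unb (lo + m)) (count (avoider? lo m) ws) a
count-avoiders-∷ {lo} {m} a ws with a ≟ˡ bar lo | a ≟ˡ unb (lo + m)
... | yes refl | yes ()
... | yes refl | no _     =
  trans (count-cong-∈ _ (avoider? (suc lo) m) {ws} λ _ → ⇔-sym avoider-bar⇔) (sym (+-identityʳ _))
... | no _     | yes refl = count-cong-∈ _ (avoider? lo m) {ws} λ _ → ⇔-sym avoider-unb⇔
... | no ≢bar  | no ≢unb  = count-none _ ws ([ ≢bar , ≢unb ] ∘ avoider-head)

count-avoiders : ∀ {N} lo m → 1 ≤ lo → lo + m ≤ suc N →
                 count (avoider? lo m) (words (alphabet N) m) ≡ 2 ^ m
count-avoiders     lo zero    _    _    = refl
count-avoiders {N} lo (suc m) 1≤lo fits = begin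
  count (avoider? lo (suc m)) (words A (suc m))
    ≡⟨ count-words-suc (avoider? lo (suc m)) A m ⟩
  sum (map (λ a → count (avoider? lo (suc m) ∘ (a ∷_)) W) A)
    ≡⟨ cong sum (map-cong (λ a → count-avoiders-∷ a W) A) ⟩
  sum (map (λ a → pointMass _≟ˡ_ (bar lo) C₁ a + pointMass _≟ˡ_ (unb (lo + m)) C₂ a) A)
    ≡⟨ sum-map-+ _ _ A ⟩
  sum (map (pointMass _≟ˡ_ (bar lo) C₁) A) + sum (map (pointMass _≟ˡ_ (unb (lo + m)) C₂) A)
    ≡⟨ cong₂ _+_ (sum-pointMass _≟ˡ_ (unique-alphabet N) bar-lo∈A)
                 (sum-pointMass _≟ˡ_ (unique-alphabet N) unb-top∈A) ⟩
  C₁ + C₂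
    ≡⟨ cong₂ _+_ (count-avoiders (suc lo) m (s≤s z≤n) top<1+N)
                 (count-avoiders lo m 1≤lo (<⇒≤ top<1+N)) ⟩
  2 ^ m + 2 ^ m
    ≡⟨ cong (2 ^ m +_) (sym (+-identityʳ (2 ^ m))) ⟩
  2 ^ suc m ∎
  where
  open ≡-Reasoning
  A : List Letter
  A = alphabet N
  W : List Word
  W = words A m
  C₁ C₂ : ℕ
  C₁ = count (avoider? (suc lo) m) W
  C₂ = count (avoider? lo m) W
  top<1+N : lo + m < suc N
  top<1+N = subst (_≤ suc N) (+-suc lo m) fits
  bar-lo∈A : bar lo ∈ A
  bar-lo∈A = ∈-alphabet⁺ true (1≤lo , ≤-<-trans (m≤m+n lo m) top<1+N)
  unb-top∈A : unb (lo + m) ∈ A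
  unb-top∈A = ∈-alphabet⁺ false (≤-trans 1≤lo (m≤m+n lo m) , top<1+N)

signedPermAvoidingT₆⇔Avoider : ∀ {N w} → w ∈ words (alphabet N) N →
  (isSignedPerm N w ≡ true × avoidsAll w T₆ ≡ true) ⇔ Avoider 1 N w
signedPermAvoidingT₆⇔Avoider {N} {w} w∈ = mk⇔
  (λ (perm , avoids) → (to (isSignedPerm⇔ N w) perm , letters) ,
                       AllPairs.map (to PairAvoidsT₆⇔CanPrecede) (to avoidsT₆⇔ avoids))
  (λ ((once , _) , pairs) → from (isSignedPerm⇔ N w) once ,
                            from avoidsT₆⇔ (AllPairs.map (from PairAvoidsT₆⇔CanPrecede) pairs))
  where
  letters : All (Interval 1 (suc N) ∘ ∣_∣ˡ) w
  letters = All.map ∈-alphabet⁻ (∈-words⁻ {n = N} w∈)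
  avoidsT₆⇔ : avoidsAll w T₆ ≡ true ⇔ AllPairs (PairAvoids T₆) w
  avoidsT₆⇔ = avoidsAll⇔AllPairs (refl ∷ refl ∷ refl ∷ refl ∷ [])

mainTheorem6 : (n : ℕ) → b n ((bar 2 ∷ bar 1 ∷ []) ∷ T₅) ≡ 2 ^ n
mainTheorem6 N = begin
  count avoids? (filter perm? (words (alphabet N) N))
    ≡⟨ count-filter perm? avoids? (words (alphabet N) N) ⟩
  count (perm? ∩? avoids?) (words (alphabet N) N)
    ≡⟨ count-cong-∈ (perm? ∩? avoids?) (avoider? 1 N) signedPermAvoidingT₆⇔Avoider ⟩
  count (avoider? 1 N) (words (alphabet N) N)
    ≡⟨ count-avoiders 1 N ≤-refl ≤-refl ⟩
  2 ^ N ∎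
  where
  open ≡-Reasoning
  perm? : Decidable (λ w → isSignedPerm N w ≡ true)
  perm? w = isSignedPerm N w ≟ᴮ true
  avoids? : Decidable (λ w → avoidsAll w T₆ ≡ true)
  avoids? w = avoidsAll w T₆ ≟ᴮ true
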